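{- Let $S$ be a single-homomorphism system of equations in standard form (as defined in the context). If the path labeled propagation graph $\mathcal{LP}$ of $S$ contains a directed cycle, then $S$ has no unifier modulo one-sided distributivity.
   Context: One-sided distributivity is the equational theory over the binary symbols $+,\times$ generated by $X \times (Y+Z) = X\times Y + X \times Z$; unification is elementary (terms built only from $+$, $\times$ and variables). Typed setting: two types $\tau_1,\tau_2$ with $\times:\tau_1*\tau_2\to\tau_2$ and $+:\tau_2*\tau_2\to\tau_2$. A single-homomorphism system is a finite set of equations in standard form in which exactly one variable $T$ has type $\tau_1$; every equation has one of the forms $X =^? Y$ ($Y$ a variable distinct from $X$), $X =^? Y + Z$, or $X =^? T \times Y$, with $X,Y,Z$ variables of type $\tau_2$; the equation $X =^? T\times Y$ is also written $X =^? h(Y)$. Write $X \succ_h Y$ if $X =^? h(Y)$ is in $S$, and $X \succ_a Z$ if $X =^? Y+Z$ or $X =^? Z+Y$ is in $S$. Let $\sim_h$ be the reflexive, symmetric, transitive closure of $\succ_h$ on the $\tau_2$-variables. The graph $\mathcal{LP}$ has as vertices the $\sim_h$-equivalence classes, and an edge from class $[X]$ to class $[Y]$ iff there are $U \in [X]$ and $V \in [Y]$ with $U \succ_a V$. -}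

module Defs where

open import Data.Nat using (ℕ)
open import Data.List using (List)
open import Data.List.Membership.Propositional using (_∈_)
open import Data.List.Relation.Unary.All using (All)
open import Data.Product using (Σ; ∃; _×_)
open import Data.Sum using (_⊎_)
open import Relation.Nullary using (¬_)
open import Data.Unit using (⊤)
open import Relation.Binary.PropositionalEquality using (_≡_)
open import Relation.Binary.Construct.Closure.Equivalence using (EqClosure)
open import Relation.Binary.Construct.Closure.Transitive using (TransClosure)

data Ty : Set where
  τ₁ τ₂ : Ty

data Tm : Ty → Set where
  var  : {t : Ty} → ℕ → Tm t
  _⊕_  : Tm τ₂ → Tm τ₂ → Tm τ₂
  _⊗_  : Tm τ₁ → Tm τ₂ → Tm τ₂

infixl 6 _⊕_
infixl 7 _⊗_

data _≈D_ : {t : Ty} → Tm t → Tm t → Set where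
  ≈refl  : {t : Ty} {s : Tm t} → s ≈D s
  ≈sym   : {t : Ty} {s u : Tm t} → s ≈D u → u ≈D s
  ≈trans : {t : Ty} {s u v : Tm t} → s ≈D u → u ≈D v → s ≈D v
  ≈cong⊕ : {s s' u u' : Tm τ₂} → s ≈D s' → u ≈D u' → (s ⊕ u) ≈D (s' ⊕ u')
  ≈cong⊗ : {s s' : Tm τ₁} {u u' : Tm τ₂} → s ≈D s' → u ≈D u' → (s ⊗ u) ≈D (s' ⊗ u')
  ≈dist  : (x : Tm τ₁) (y z : Tm τ₂) → (x ⊗ (y ⊕ z)) ≈D ((x ⊗ y) ⊕ (x ⊗ z))

infix 4 _≈D_

Subst : Set
Subst = (t : Ty) → ℕ → Tm t

_⟨_⟩ : {t : Ty} → Tm t → Subst → Tm t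
var {t} x ⟨ σ ⟩ = σ t x
(s ⊕ u) ⟨ σ ⟩ = (s ⟨ σ ⟩) ⊕ (u ⟨ σ ⟩)
(s ⊗ u) ⟨ σ ⟩ = (s ⟨ σ ⟩) ⊗ (u ⟨ σ ⟩)

-- Single-homomorphism systems in standard form.
-- All named variables in equations are of type τ₂; the unique τ₁
-- variable T is a parameter of the system.

data Equation : Set where
  eqVar : ℕ → ℕ → Equation          -- X =? Y
  eqAdd : ℕ → ℕ → ℕ → Equation      -- X =? Y + Z
  eqHom : ℕ → ℕ → Equation          -- X =? T × Y   (i.e. X =? h(Y))

-- standard-form side condition: in X =? Y the variables are distinct
WellFormedEq : Equation → Set
WellFormedEq (eqVar X Y)   = ¬ (X ≡ Y)
WellFormedEq (eqAdd X Y Z) = ⊤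
WellFormedEq (eqHom X Y)   = ⊤

record SHSystem : Set where
  field
    T    : ℕ
    eqs  : List Equation
    wf   : All WellFormedEq eqs

open SHSystem public

lhs : ℕ → Equation → Tm τ₂
lhs T (eqVar X Y)   = var X
lhs T (eqAdd X Y Z) = var X
lhs T (eqHom X Y)   = var X

rhs : ℕ → Equation → Tm τ₂
rhs T (eqVar X Y)   = var Y
rhs T (eqAdd X Y Z) = var Y ⊕ var Z
rhs T (eqHom X Y)   = var {τ₁} T ⊗ var Y

IsUnifier : SHSystem → Subst → Set
IsUnifier S σ = ∀ {e} → e ∈ eqs S → (lhs (T S) e ⟨ σ ⟩) ≈D (rhs (T S) e ⟨ σ ⟩)

HasUnifier : SHSystem → Set
HasUnifier S = Σ Subst (IsUnifier S)

_⊢_≻h_ : SHSystem → ℕ → ℕ → Set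
S ⊢ X ≻h Y = eqHom X Y ∈ eqs S

_⊢_≻a_ : SHSystem → ℕ → ℕ → Set
S ⊢ X ≻a Z = ∃ λ Y → (eqAdd X Y Z ∈ eqs S) ⊎ (eqAdd X Z Y ∈ eqs S)

_⊢_∼h_ : SHSystem → ℕ → ℕ → Set
S ⊢ X ∼h Y = EqClosure (S ⊢_≻h_) X Y

-- edge in LP from class [X] to class [Y] (stated on representatives;
-- it depends only on the ∼h-classes)
LPEdge : SHSystem → ℕ → ℕ → Set
LPEdge S X Y = ∃ λ U → ∃ λ V → (S ⊢ X ∼h U) × (S ⊢ Y ∼h V) × (S ⊢ U ≻a V)

HasCycle : SHSystem → Set
HasCycle S = ∃ λ X → TransClosure (LPEdge S) X X

-- Count the τ₂-leaves of a term, i.e. its summands once every product is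
-- distributed. Both sides of X × (Y + Z) = X × Y + X × Z have as many
-- leaves as Y + Z, so the count is an invariant of one-sided
-- distributivity. Under a unifier the count of σ(X) is therefore equal on
-- the two sides of X =? h(Y), constant on ∼h-classes, and strictly larger
-- than that of σ(Z) whenever X ≻a Z, since every term has a leaf. It thus
-- strictly decreases along each edge of LP, which rules out a cycle.
module Submission where

open import Defs
open import Data.Nat using (ℕ; _+_; _<_; _>_; s≤s; z≤n)
open import Data.Nat.Properties using (<-trans; <-irrefl; m<m+n; m<n+m; +-mono-≤)
open import Data.Product using (_,_)
open import Data.Sum using (inj₁; inj₂)
open import Level using (Level)
open import Relation.Binary.Core using (Rel)
open import Relation.Binary.Construct.Closure.Equivalence using (gfold)
open import Relation.Binary.Construct.Closure.Transitive using (TransClosure; [_]; _∷_)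
open import Relation.Binary.PropositionalEquality using (_≡_; refl; sym; trans; cong₂; isEquivalence)
open import Relation.Nullary using (¬_)

leaves : {t : Ty} → Tm t → ℕ
leaves {τ₁} _       = 0
leaves {τ₂} (var _) = 1
leaves {τ₂} (s ⊕ u) = leaves s + leaves u
leaves {τ₂} (_ ⊗ u) = leaves u

leaves-positive : (s : Tm τ₂) → leaves s > 0
leaves-positive (var _) = s≤s z≤n
leaves-positive (s ⊕ u) = +-mono-≤ (leaves-positive s) z≤n
leaves-positive (_ ⊗ u) = leaves-positive u

leaves-resp-≈D : {t : Ty} {s u : Tm t} → s ≈D u → leaves s ≡ leaves u
leaves-resp-≈D ≈refl         = refl
leaves-resp-≈D (≈sym p)      = sym (leaves-resp-≈D p)
leaves-resp-≈D (≈trans p q)  = trans (leaves-resp-≈D p) (leaves-resp-≈D q)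
leaves-resp-≈D (≈cong⊕ p q)  = cong₂ _+_ (leaves-resp-≈D p) (leaves-resp-≈D q)
leaves-resp-≈D (≈cong⊗ _ q)  = leaves-resp-≈D q
leaves-resp-≈D (≈dist _ _ _) = refl

measure-decreasing⇒acyclic : {a ℓ : Level} {A : Set a} {R : Rel A ℓ} (f : A → ℕ) →
                             (∀ {x y} → R x y → f y < f x) →
                             ∀ {x} → ¬ TransClosure R x x
measure-decreasing⇒acyclic {R = R} f decreasing cycle = <-irrefl refl (decreasing⁺ cycle)
  where
  decreasing⁺ : ∀ {x y} → TransClosure R x y → f y < f x
  decreasing⁺ [ xRy ]       = decreasing xRy
  decreasing⁺ (xRy ∷ yR⁺z) = <-trans (decreasing⁺ yR⁺z) (decreasing xRy)

module _ (S : SHSystem) (σ : Subst) (unifier : IsUnifier S σ) where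

  weight : ℕ → ℕ
  weight X = leaves (σ τ₂ X)

  ≻h⇒weight≡ : ∀ {X Y} → S ⊢ X ≻h Y → weight X ≡ weight Y
  ≻h⇒weight≡ X≻hY = leaves-resp-≈D (unifier X≻hY)

  ∼h⇒weight≡ : ∀ {X Y} → S ⊢ X ∼h Y → weight X ≡ weight Y
  ∼h⇒weight≡ = gfold isEquivalence weight ≻h⇒weight≡

  ≻a⇒weight> : ∀ {X Z} → S ⊢ X ≻a Z → weight Z < weight X
  ≻a⇒weight> {X} {Z} (Y , inj₁ X=Y+Z) rewrite leaves-resp-≈D (unifier X=Y+Z) =
    m<n+m (weight Z) (leaves-positive (σ τ₂ Y))
  ≻a⇒weight> {X} {Z} (Y , inj₂ X=Z+Y) rewrite leaves-resp-≈D (unifier X=Z+Y) =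
    m<m+n (weight Z) (leaves-positive (σ τ₂ Y))

  LPEdge⇒weight> : ∀ {X Y} → LPEdge S X Y → weight Y < weight X
  LPEdge⇒weight> (_ , _ , X∼U , Y∼V , U≻aV)
    rewrite ∼h⇒weight≡ X∼U | ∼h⇒weight≡ Y∼V = ≻a⇒weight> U≻aV

lemma5p7 : (S : SHSystem) → HasCycle S → ¬ HasUnifier S
lemma5p7 S (_ , cycle) (σ , unifier) =
  measure-decreasing⇒acyclic (weight S σ unifier) (LPEdge⇒weight> S σ unifier) cycle
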